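{- Let $n\ge2$ and $p\in(0,1)$. Let $G_1$ be a random undirected Erdős–Rényi graph on $\{1,\dots,n\}$ (symmetric $0/1$ adjacency matrix with zero diagonal, entries $G_1(i,j)$, $i<j$, i.i.d. Bernoulli$(p)$), let $P$ be a fixed $n\times n$ permutation matrix and $G_2=PG_1P^T$. Let $s_1>s_2>s_3>0$ and define, for $i,r,j',s'\in\{1,\dots,n\}$, $A[(i,j'),(r,s')]=(s_1+s_2-2s_3)G_1(i,r)G_2(j',s')+(s_3-s_2)(G_1(i,r)+G_2(j',s'))+s_2$. For an $n\times n$ permutation matrix $X$ let $J(X)=\sum_{i,j',r,s'}X(i,j')X(r,s')A[(i,j'),(r,s')]$. Then the alignment $X=P^T$ (mapping each node of $G_1$ to its image under the isomorphism) maximizes $\mathbb{E}[J(X)]$ over all $n\times n$ permutation matrices $X$, the expectation being over realizations of $G_1$ and $G_2$.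
   Context: $X(i,j')=1$ means node $i$ of $G_1$ is aligned to node $j'$ of $G_2$. $J(X)$ equals $s_1(\#\text{matches})+s_2(\#\text{neutrals})+s_3(\#\text{mismatches})$ over ordered pairs of mapping edges.
   Formalization: The edge probability p and the scores s₁, s₂, s₃ take rational values. -}

module Defs where

open import Data.Bool using (Bool; true; false; if_then_else_; _∧_)
open import Data.Nat as ℕ using (ℕ; zero; suc; _<ᵇ_)
open import Data.Fin using (Fin; toℕ; _≟_)
import Data.Fin
import Data.Nat
open import Data.Fin.Permutation using (Permutation′; _⟨$⟩ʳ_)
open import Data.List using (List; []; _∷_; concatMap; filter; map)
open import Data.List using () renaming (allFin to allFinL)
open import Data.Product using (_×_; _,_)
open import Data.Rational using (ℚ; 0ℚ; 1ℚ; _+_; _*_; _-_)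
open import Relation.Nullary.Decidable using (does)

Mat : ℕ → Set
Mat n = Fin n → Fin n → ℚ

Σ : ∀ {n} → (Fin n → ℚ) → ℚ
Σ {zero}  f = 0ℚ
Σ {suc n} f = f Data.Fin.zero + Σ {n} (λ i → f (Data.Fin.suc i))


_ᵀ : ∀ {n} → Mat n → Mat n
(M ᵀ) i j = M j i

_·_ : ∀ {n} → Mat n → Mat n → Mat n
(M · N) i j = Σ (λ k → M i k * N k j)

permMatrix : ∀ {n} → Permutation′ n → Mat n
permMatrix σ i j = if does ((σ ⟨$⟩ʳ i) ≟ j) then 1ℚ else 0ℚ

-- A realization of the random edge indicators: only the entries (i , j)
-- with i < j are used (they are the i.i.d. Bernoulli(p) variables).
Real : ℕ → Set
Real n = Fin n → Fin n → Bool

allFalse : ∀ {n} → Real n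
allFalse _ _ = false

set : ∀ {n} → Real n → Fin n → Fin n → Bool → Real n
set ω i j b k l = if does (k ≟ i) ∧ does (l ≟ j) then b else ω k l

pairs : (n : ℕ) → List (Fin n × Fin n)
pairs n = concatMap (λ i → map (λ j → (i , j))
                         (filter (λ j → Data.Nat._<?_ (toℕ i) (toℕ j)) (allFinL n)))
                    (allFinL n)


ExpOver : ∀ {n} → ℚ → List (Fin n × Fin n) → Real n → (Real n → ℚ) → ℚ
ExpOver p []             ω f = f ω
ExpOver p ((i , j) ∷ ps) ω f =
  p * ExpOver p ps (set ω i j true) f + (1ℚ - p) * ExpOver p ps (set ω i j false) f

𝔼 : ∀ {n} → ℚ → (Real n → ℚ) → ℚ
𝔼 {n} p f = ExpOver p (pairs n) allFalse f

b2q : Bool → ℚ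
b2q true  = 1ℚ
b2q false = 0ℚ

G₁ : ∀ {n} → Real n → Mat n
G₁ ω i j = if toℕ i <ᵇ toℕ j then b2q (ω i j)
           else if toℕ j <ᵇ toℕ i then b2q (ω j i) else 0ℚ

G₂ : ∀ {n} → Mat n → Real n → Mat n
G₂ P ω = (P · G₁ ω) · (P ᵀ)

A : ∀ {n} → (s₁ s₂ s₃ : ℚ) → Mat n → Real n → Fin n → Fin n → Fin n → Fin n → ℚ
A s₁ s₂ s₃ P ω i j' r s' =
  (s₁ + s₂ - (s₃ + s₃)) * (G₁ ω i r * G₂ P ω j' s')
  + (s₃ - s₂) * (G₁ ω i r + G₂ P ω j' s') + s₂

J : ∀ {n} → (s₁ s₂ s₃ : ℚ) → Mat n → Real n → Mat n → ℚ
J s₁ s₂ s₃ P ω X =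
  Σ λ i → Σ λ j' → Σ λ r → Σ λ s' → X i j' * X r s' * A s₁ s₂ s₃ P ω i j' r s'

{-# OPTIONS --safe #-}
-- The inequality holds for every realization ω, so it survives taking expectations.
-- A[(i,j'),(r,s')] = f(G₁ i r , G₂ j' s') with f(x , y) = c·x·y + d·(x + y) + e and
-- c = s₁ + s₂ − 2 s₃ ≥ 0. As G₂ is G₁ relabelled by π, the alignment σ scores
-- Σ_{i,r} f(g i r , g (ρ i) (ρ r)) with g = G₁ and ρ = π ∘ σ, and Pᵀ gives ρ = id.
-- Since f(x , x) + f(y , y) − 2 f(x , y) = c (x − y)² ≥ 0 and relabelling by ρ only
-- permutes the pairs (i , r), the score of σ is at most that of Pᵀ.
module Submission where

open import Defs
open import Data.Nat using (ℕ; _≤_; zero; suc)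
open import Data.Fin.Permutation using (Permutation′)
open import Data.Rational using (ℚ; 0ℚ; 1ℚ; _<_)
open import Data.Rational renaming (_≤_ to _≤ℚ_)

open import Data.Bool using (true; false; if_then_else_)
open import Data.Fin using (Fin) renaming (zero to fzero; suc to fsuc; _≟_ to _≟ᶠ_)
open import Data.Fin.Permutation using (_⟨$⟩ʳ_; _⟨$⟩ˡ_; _∘ₚ_; flip; inverseˡ; inverseʳ)
open import Data.List using (List; []; _∷_)
open import Data.Product using (_×_; _,_)
open import Data.Sum using (inj₁; inj₂)
open import Function using (_∘_)
open import Relation.Nullary using (yes; no; does)
open import Relation.Nullary.Negation using (contradiction)
open import Relation.Binary.PropositionalEquality hiding (J)
open import Data.Rational.Properties
open import Data.Rational.Solver using (module +-*-Solver)
open import Algebra.Bundles using (CommutativeRing)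
import Algebra.Properties.Semiring.Sum as SemiringSum

private
  variable
    n : ℕ

  module ∑ = SemiringSum (CommutativeRing.semiring +-*-commutativeRing)

p≤q⇒0≤q-p : ∀ {p q} → p ≤ℚ q → 0ℚ ≤ℚ q - p
p≤q⇒0≤q-p {p} {q} p≤q = subst (_≤ℚ q - p) (+-inverseʳ p) (+-monoˡ-≤ (- p) p≤q)

0≤p⇒q≤q+p : ∀ {p} q → 0ℚ ≤ℚ p → q ≤ℚ q + p
0≤p⇒q≤q+p q 0≤p = subst (_≤ℚ q + _) (+-identityʳ q) (+-monoʳ-≤ q 0≤p)

0≤p*p : ∀ p → 0ℚ ≤ℚ p * p
0≤p*p p with ≤-total 0ℚ p
... | inj₁ 0≤p = subst (_≤ℚ p * p) (*-zeroʳ p) (*-monoˡ-≤-nonNeg p {{nonNegative 0≤p}} 0≤p)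
... | inj₂ p≤0 = subst (_≤ℚ p * p) (*-zeroʳ p) (*-monoˡ-≤-nonPos p {{nonPositive p≤0}} p≤0)

p+p≤q+q⇒p≤q : ∀ {p q} → p + p ≤ℚ q + q → p ≤ℚ q
p+p≤q+q⇒p≤q {p} {q} p+p≤q+q with p ≤? q
... | yes p≤q = p≤q
... | no p≰q = contradiction (<-≤-trans (+-mono-< q<p q<p) p+p≤q+q) (<-irrefl refl)
  where
  q<p : q < p
  q<p = ≰⇒> p≰q

Σ≡sum : (f : Fin n → ℚ) → Σ f ≡ ∑.sum f
Σ≡sum {zero}  f = refl
Σ≡sum {suc n} f = cong (f fzero +_) (Σ≡sum (f ∘ fsuc))

Σ-cong : {f g : Fin n → ℚ} → (∀ i → f i ≡ g i) → Σ f ≡ Σ g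
Σ-cong {zero}  f≗g = refl
Σ-cong {suc n} f≗g = cong₂ _+_ (f≗g fzero) (Σ-cong (f≗g ∘ fsuc))

Σ-mono-≤ : {f g : Fin n → ℚ} → (∀ i → f i ≤ℚ g i) → Σ f ≤ℚ Σ g
Σ-mono-≤ {zero}  f≤g = ≤-refl
Σ-mono-≤ {suc n} f≤g = +-mono-≤ (f≤g fzero) (Σ-mono-≤ (f≤g ∘ fsuc))

Σ-zero : Σ {n} (λ _ → 0ℚ) ≡ 0ℚ
Σ-zero {n} = trans (Σ≡sum {n} _) (∑.sum-replicate-zero n)

Σ-distrib-+ : (f g : Fin n → ℚ) → Σ (λ i → f i + g i) ≡ Σ f + Σ g
Σ-distrib-+ f g =
  trans (Σ≡sum (λ i → f i + g i)) (trans (∑.∑-distrib-+ f g) (sym (cong₂ _+_ (Σ≡sum f) (Σ≡sum g))))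

*-distribˡ-Σ : (c : ℚ) (f : Fin n → ℚ) → c * Σ f ≡ Σ (λ i → c * f i)
*-distribˡ-Σ c f =
  trans (cong (c *_) (Σ≡sum f)) (trans (∑.*-distribˡ-sum c f) (sym (Σ≡sum (λ i → c * f i))))

Σ-permute : (f : Fin n → ℚ) (ρ : Permutation′ n) → Σ f ≡ Σ (f ∘ (ρ ⟨$⟩ʳ_))
Σ-permute f ρ = trans (Σ≡sum f) (trans (∑.sum-permute f ρ) (sym (Σ≡sum (f ∘ (ρ ⟨$⟩ʳ_)))))

Σ² : (Fin n → Fin n → ℚ) → ℚ
Σ² f = Σ λ i → Σ (f i)

Σ²-cong : {f g : Fin n → Fin n → ℚ} → (∀ i r → f i r ≡ g i r) → Σ² f ≡ Σ² g
Σ²-cong f≗g = Σ-cong λ i → Σ-cong (f≗g i)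

Σ²-mono-≤ : {f g : Fin n → Fin n → ℚ} → (∀ i r → f i r ≤ℚ g i r) → Σ² f ≤ℚ Σ² g
Σ²-mono-≤ f≤g = Σ-mono-≤ λ i → Σ-mono-≤ (f≤g i)

Σ²-distrib-+ : (f g : Fin n → Fin n → ℚ) → Σ² (λ i r → f i r + g i r) ≡ Σ² f + Σ² g
Σ²-distrib-+ f g =
  trans (Σ-cong λ i → Σ-distrib-+ (f i) (g i)) (Σ-distrib-+ (λ i → Σ (f i)) (λ i → Σ (g i)))

Σ²-permute : (f : Fin n → Fin n → ℚ) (ρ : Permutation′ n) →
  Σ² f ≡ Σ² (λ i r → f (ρ ⟨$⟩ʳ i) (ρ ⟨$⟩ʳ r))
Σ²-permute f ρ =
  trans (Σ-permute (λ i → Σ (f i)) ρ) (Σ-cong λ i → Σ-permute (f (ρ ⟨$⟩ʳ i)) ρ)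

δ : Fin n → Fin n → ℚ
δ i j = if does (i ≟ᶠ j) then 1ℚ else 0ℚ

Σ-selectˡ : (k : Fin n) (h : Fin n → ℚ) → Σ (λ j → δ k j * h j) ≡ h k
Σ-selectˡ {suc n} fzero h = begin
    1ℚ * h fzero + Σ (λ j → 0ℚ * h (fsuc j))
  ≡⟨ cong₂ _+_ (*-identityˡ (h fzero)) (trans (Σ-cong λ j → *-zeroˡ (h (fsuc j))) (Σ-zero {n})) ⟩
    h fzero + 0ℚ
  ≡⟨ +-identityʳ _ ⟩
    h fzero ∎
  where open ≡-Reasoning
Σ-selectˡ {suc n} (fsuc k) h = begin
    0ℚ * h fzero + Σ (λ j → δ k j * h (fsuc j))
  ≡⟨ cong₂ _+_ (*-zeroˡ (h fzero)) (Σ-selectˡ k (h ∘ fsuc)) ⟩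
    0ℚ + h (fsuc k)
  ≡⟨ +-identityˡ _ ⟩
    h (fsuc k) ∎
  where open ≡-Reasoning

Σ-selectʳ : (k : Fin n) (h : Fin n → ℚ) → Σ (λ j → h j * δ k j) ≡ h k
Σ-selectʳ k h = trans (Σ-cong λ j → *-comm (h j) (δ k j)) (Σ-selectˡ k h)

permMatrix-ᵀ : (π : Permutation′ n) → ∀ i j → (permMatrix π ᵀ) i j ≡ permMatrix (flip π) i j
permMatrix-ᵀ π i j with π ⟨$⟩ʳ j ≟ᶠ i | π ⟨$⟩ˡ i ≟ᶠ j
... | yes _  | yes _  = refl
... | no _   | no _   = refl
... | yes πj≡i | no πˡi≢j = contradiction (trans (cong (π ⟨$⟩ˡ_) (sym πj≡i)) (inverseˡ π)) πˡi≢j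
... | no πj≢i | yes πˡi≡j = contradiction (trans (cong (π ⟨$⟩ʳ_) (sym πˡi≡j)) (inverseʳ π)) πj≢i

permMatrix-· : (π : Permutation′ n) (M : Mat n) → ∀ i j → (permMatrix π · M) i j ≡ M (π ⟨$⟩ʳ i) j
permMatrix-· π M i j = Σ-selectˡ (π ⟨$⟩ʳ i) (λ k → M k j)

·-permMatrixᵀ : (π : Permutation′ n) (M : Mat n) → ∀ i j → (M · (permMatrix π ᵀ)) i j ≡ M i (π ⟨$⟩ʳ j)
·-permMatrixᵀ π M i j = Σ-selectʳ (π ⟨$⟩ʳ j) (M i)

G₂-permMatrix : (π : Permutation′ n) (ω : Real n) → ∀ i j →
  G₂ (permMatrix π) ω i j ≡ G₁ ω (π ⟨$⟩ʳ i) (π ⟨$⟩ʳ j)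
G₂-permMatrix π ω i j =
  trans (·-permMatrixᵀ π (permMatrix π · G₁ ω) i j) (permMatrix-· π (G₁ ω) i (π ⟨$⟩ʳ j))

Σ⁴-permMatrix : (σ : Permutation′ n) (K : Fin n → Fin n → Fin n → Fin n → ℚ) →
  (Σ λ i → Σ λ j → Σ λ r → Σ λ s → permMatrix σ i j * permMatrix σ r s * K i j r s)
    ≡ Σ² (λ i r → K i (σ ⟨$⟩ʳ i) r (σ ⟨$⟩ʳ r))
Σ⁴-permMatrix σ K = Σ-cong λ i → begin
    Σ (λ j → Σ λ r → Σ λ s → X i j * X r s * K i j r s)
  ≡⟨ Σ-cong (λ j → Σ-cong λ r → Σ-cong λ s → swap-left (X i j) (X r s) (K i j r s)) ⟩
    Σ (λ j → Σ λ r → Σ λ s → X r s * (X i j * K i j r s))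
  ≡⟨ Σ-cong (λ j → Σ-cong λ r → Σ-selectˡ (σ ⟨$⟩ʳ r) (λ s → X i j * K i j r s)) ⟩
    Σ (λ j → Σ λ r → X i j * K i j r (σ ⟨$⟩ʳ r))
  ≡⟨ Σ-cong (λ j → *-distribˡ-Σ (X i j) (λ r → K i j r (σ ⟨$⟩ʳ r))) ⟨
    Σ (λ j → X i j * Σ λ r → K i j r (σ ⟨$⟩ʳ r))
  ≡⟨ Σ-selectˡ (σ ⟨$⟩ʳ i) _ ⟩
    Σ (λ r → K i (σ ⟨$⟩ʳ i) r (σ ⟨$⟩ʳ r)) ∎
  where
  open ≡-Reasoning
  X : Mat _
  X = permMatrix σ
  swap-left : ∀ a b c → a * b * c ≡ b * (a * c)
  swap-left a b c = trans (cong (_* c) (*-comm a b)) (*-assoc b a c)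

-- On 0/1 entries: s₁ on a match (1 , 1), s₂ on a neutral pair (0 , 0), s₃ on a mismatch.
edgeScore : (s₁ s₂ s₃ x y : ℚ) → ℚ
edgeScore s₁ s₂ s₃ x y = (s₁ + s₂ - (s₃ + s₃)) * (x * y) + (s₃ - s₂) * (x + y) + s₂

edgeScore-mixed≤diagonal : ∀ s₁ s₂ s₃ → s₃ + s₃ ≤ℚ s₁ + s₂ → ∀ x y →
  let f = edgeScore s₁ s₂ s₃ in f x y + f x y ≤ℚ f x x + f y y
edgeScore-mixed≤diagonal s₁ s₂ s₃ 2s₃≤s₁+s₂ x y =
  subst (f x y + f x y ≤ℚ_) (sym diagonal≡mixed+square) (0≤p⇒q≤q+p (f x y + f x y) 0≤c·[x-y]²)
  where
  open +-*-Solver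
  f : ℚ → ℚ → ℚ
  f = edgeScore s₁ s₂ s₃
  c : ℚ
  c = s₁ + s₂ - (s₃ + s₃)
  0≤c·[x-y]² : 0ℚ ≤ℚ c * ((x - y) * (x - y))
  0≤c·[x-y]² = subst (_≤ℚ c * _) (*-zeroʳ c)
    (*-monoˡ-≤-nonNeg c {{nonNegative (p≤q⇒0≤q-p 2s₃≤s₁+s₂)}} (0≤p*p (x - y)))
  diagonal≡mixed+square :
    f x x + f y y ≡ (f x y + f x y) + c * ((x - y) * (x - y))
  diagonal≡mixed+square = solve 5 (λ c d e x y →
      ((c :* (x :* x) :+ d :* (x :+ x) :+ e) :+ (c :* (y :* y) :+ d :* (y :+ y) :+ e))
      := ((c :* (x :* y) :+ d :* (x :+ y) :+ e) :+ (c :* (x :* y) :+ d :* (x :+ y) :+ e))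
         :+ c :* ((x :- y) :* (x :- y)))
    refl c (s₃ - s₂) s₂ x y

Σ²-edgeScore-permute-≤ : ∀ s₁ s₂ s₃ → s₃ + s₃ ≤ℚ s₁ + s₂ →
  (g : Fin n → Fin n → ℚ) (ρ : Permutation′ n) →
  let f = edgeScore s₁ s₂ s₃ in
  Σ² (λ i r → f (g i r) (g (ρ ⟨$⟩ʳ i) (ρ ⟨$⟩ʳ r))) ≤ℚ Σ² (λ i r → f (g i r) (g i r))
Σ²-edgeScore-permute-≤ s₁ s₂ s₃ 2s₃≤s₁+s₂ g ρ = p+p≤q+q⇒p≤q (begin
    Σ² mixed + Σ² mixed
  ≡⟨ Σ²-distrib-+ mixed mixed ⟨
    Σ² (λ i r → mixed i r + mixed i r)
  ≤⟨ Σ²-mono-≤ (λ i r → edgeScore-mixed≤diagonal s₁ s₂ s₃ 2s₃≤s₁+s₂ (g i r) (gρ i r)) ⟩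
    Σ² (λ i r → diagonal i r + diagonal (ρ ⟨$⟩ʳ i) (ρ ⟨$⟩ʳ r))
  ≡⟨ Σ²-distrib-+ diagonal _ ⟩
    Σ² diagonal + Σ² (λ i r → diagonal (ρ ⟨$⟩ʳ i) (ρ ⟨$⟩ʳ r))
  ≡⟨ cong (Σ² diagonal +_) (Σ²-permute diagonal ρ) ⟨
    Σ² diagonal + Σ² diagonal ∎)
  where
  open ≤-Reasoning
  f : ℚ → ℚ → ℚ
  f = edgeScore s₁ s₂ s₃
  gρ mixed diagonal : Fin _ → Fin _ → ℚ
  gρ i r = g (ρ ⟨$⟩ʳ i) (ρ ⟨$⟩ʳ r)
  mixed i r = f (g i r) (gρ i r)
  diagonal i r = f (g i r) (g i r)

J-cong : ∀ s₁ s₂ s₃ (P : Mat n) (ω : Real n) {X Y : Mat n} → (∀ i j → X i j ≡ Y i j) →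
  J s₁ s₂ s₃ P ω X ≡ J s₁ s₂ s₃ P ω Y
J-cong s₁ s₂ s₃ P ω X≗Y = Σ-cong λ i → Σ-cong λ j → Σ-cong λ r → Σ-cong λ s →
  cong (_* A s₁ s₂ s₃ P ω i j r s) (cong₂ _*_ (X≗Y i j) (X≗Y r s))

J-permMatrix : ∀ s₁ s₂ s₃ (π σ : Permutation′ n) (ω : Real n) →
  J s₁ s₂ s₃ (permMatrix π) ω (permMatrix σ)
    ≡ Σ² (λ i r → edgeScore s₁ s₂ s₃ (G₁ ω i r) (G₁ ω ((σ ∘ₚ π) ⟨$⟩ʳ i) ((σ ∘ₚ π) ⟨$⟩ʳ r)))
J-permMatrix s₁ s₂ s₃ π σ ω =
  trans (Σ⁴-permMatrix σ (A s₁ s₂ s₃ (permMatrix π) ω))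
        (Σ²-cong λ i r → cong (edgeScore s₁ s₂ s₃ (G₁ ω i r))
                              (G₂-permMatrix π ω (σ ⟨$⟩ʳ i) (σ ⟨$⟩ʳ r)))

J-permMatrix≤J-transpose : ∀ s₁ s₂ s₃ → s₃ + s₃ ≤ℚ s₁ + s₂ →
  (π σ : Permutation′ n) (ω : Real n) →
  J s₁ s₂ s₃ (permMatrix π) ω (permMatrix σ) ≤ℚ J s₁ s₂ s₃ (permMatrix π) ω (permMatrix π ᵀ)
J-permMatrix≤J-transpose s₁ s₂ s₃ 2s₃≤s₁+s₂ π σ ω = begin
    J s₁ s₂ s₃ P ω (permMatrix σ)
  ≡⟨ J-permMatrix s₁ s₂ s₃ π σ ω ⟩
    Σ² (λ i r → f (g i r) (g ((σ ∘ₚ π) ⟨$⟩ʳ i) ((σ ∘ₚ π) ⟨$⟩ʳ r)))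
  ≤⟨ Σ²-edgeScore-permute-≤ s₁ s₂ s₃ 2s₃≤s₁+s₂ g (σ ∘ₚ π) ⟩
    Σ² (λ i r → f (g i r) (g i r))
  ≡⟨ Σ²-cong (λ i r → cong (f (g i r)) (cong₂ g (inverseʳ π) (inverseʳ π))) ⟨
    Σ² (λ i r → f (g i r) (g ((flip π ∘ₚ π) ⟨$⟩ʳ i) ((flip π ∘ₚ π) ⟨$⟩ʳ r)))
  ≡⟨ J-permMatrix s₁ s₂ s₃ π (flip π) ω ⟨
    J s₁ s₂ s₃ P ω (permMatrix (flip π))
  ≡⟨ J-cong s₁ s₂ s₃ P ω (permMatrix-ᵀ π) ⟨
    J s₁ s₂ s₃ P ω (P ᵀ) ∎
  where
  open ≤-Reasoning
  P g : Mat _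
  P = permMatrix π
  g = G₁ ω
  f : ℚ → ℚ → ℚ
  f = edgeScore s₁ s₂ s₃

ExpOver-mono : ∀ {p} → 0ℚ ≤ℚ p → p ≤ℚ 1ℚ → (ps : List (Fin n × Fin n)) (ω : Real n)
  {f g : Real n → ℚ} → (∀ ω → f ω ≤ℚ g ω) → ExpOver p ps ω f ≤ℚ ExpOver p ps ω g
ExpOver-mono 0≤p p≤1 []             ω f≤g = f≤g ω
ExpOver-mono {p = p} 0≤p p≤1 ((i , j) ∷ ps) ω f≤g =
  +-mono-≤ (*-monoˡ-≤-nonNeg p {{nonNegative 0≤p}}
             (ExpOver-mono 0≤p p≤1 ps (set ω i j true) f≤g))
           (*-monoˡ-≤-nonNeg (1ℚ - p) {{nonNegative (p≤q⇒0≤q-p p≤1)}}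
             (ExpOver-mono 0≤p p≤1 ps (set ω i j false) f≤g))

𝔼-mono : ∀ {p} → 0ℚ ≤ℚ p → p ≤ℚ 1ℚ → {f g : Real n → ℚ} → (∀ ω → f ω ≤ℚ g ω) → 𝔼 p f ≤ℚ 𝔼 p g
𝔼-mono {n} 0≤p p≤1 = ExpOver-mono 0≤p p≤1 (pairs n) allFalse

lemma1 : (n : ℕ) → 2 ≤ n → (p : ℚ) → 0ℚ < p → p < 1ℚ →
  (s₁ s₂ s₃ : ℚ) → s₂ < s₁ → s₃ < s₂ → 0ℚ < s₃ →
  (π : Permutation′ n) →
  let P = permMatrix π in
  (σ : Permutation′ n) →
    𝔼 p (λ ω → J s₁ s₂ s₃ P ω (permMatrix σ)) ≤ℚ 𝔼 p (λ ω → J s₁ s₂ s₃ P ω (P ᵀ))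
lemma1 n _ p 0<p p<1 s₁ s₂ s₃ s₂<s₁ s₃<s₂ _ π σ =
  𝔼-mono (<⇒≤ 0<p) (<⇒≤ p<1) (J-permMatrix≤J-transpose s₁ s₂ s₃ 2s₃≤s₁+s₂ π σ)
  where
  2s₃≤s₁+s₂ : s₃ + s₃ ≤ℚ s₁ + s₂
  2s₃≤s₁+s₂ = +-mono-≤ (<⇒≤ (<-trans s₃<s₂ s₂<s₁)) (<⇒≤ s₃<s₂)
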